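{- Let $G$ be a recursive Eulerian triangulation. Then there is a $5$-dynamic $6$-coloring of $G$ such that, whenever $u$ and $v$ are adjacent vertices of degree $4$ in $G$, we have $L_G(u)\neq L_G(v)$. In particular, $\chi_5(G)\leq 6$.
   Context: Recursive Eulerian triangulations are defined recursively: a triangle is a recursive Eulerian triangulation; and if $G'$ is a recursive Eulerian triangulation (as a plane graph) with a face bounded by the triangle $xyz$, then the plane graph obtained by drawing a new triangle $abc$ inside this face and adding the edges $ay, az, bx, bz, cx, cy$ (so that the subgraph induced by $\{x,y,z,a,b,c\}$ is an octahedron) is a recursive Eulerian triangulation. A $k$-coloring of a graph is a partition of its vertex set into $k$ independent sets (color classes, some possibly empty). A coloring is $r$-dynamic if each vertex $v$ has neighbors in at least $\min\{r,d(v)\}$ distinct color classes, where $d(v)$ is the degree of $v$. $\chi_r(G)$ is the minimum number of colors in an $r$-dynamic coloring of $G$. For a fixed coloring of $G$ and a vertex $u$, $L_G(u)$ denotes the set of colors that do not appear on the closed neighborhood $N(u)\cup\{u\}$. -}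

module Defs where

open import Data.Nat using (ℕ; zero; suc; _+_; _<_; _≤_; _⊓_)
open import Data.Nat.Properties using () renaming (_≟_ to _≟ℕ_)
open import Data.Fin using (Fin)
open import Data.Fin.Properties using () renaming (_≟_ to _≟F_)
open import Data.Product using (_×_; _,_; Σ; ∃)
open import Data.Product.Properties using (≡-dec)
open import Data.Sum using (_⊎_)
open import Data.List using (List; []; _∷_; _++_; filter; length; upTo; allFin)
open import Data.List.Relation.Unary.Any using (Any; _─_; any?)
open import Data.List.Membership.Propositional using (_∈_)
open import Data.List.Membership.DecPropositional (≡-dec _≟ℕ_ _≟ℕ_) using (_∈?_)
open import Relation.Nullary using (¬_; Dec)
open import Relation.Nullary.Decidable using (_⊎-dec_)
open import Relation.Binary.PropositionalEquality using (_≡_; _≢_)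

-- Vertices are natural numbers 0,…,n-1; an edge is an (unordered) pair
-- stored as an ordered pair in the edge list; a face is a triangle given
-- by its three boundary vertices.
Edge : Set
Edge = ℕ × ℕ

Face : Set
Face = ℕ × ℕ × ℕ

-- Recursive Eulerian triangulations as plane graphs, recorded combinatorially
-- by (number of vertices, edge list, list of facial triangles).
-- base : the triangle 012, with its two faces (inside and outside).
-- step : pick a face bounded by xyz, put a new triangle abc inside
--        (a = n, b = n+1, c = n+2) and add ay, az, bx, bz, cx, cy.
data RET : ℕ → List Edge → List Face → Set where
  base : RET 3 ((0 , 1) ∷ (1 , 2) ∷ (0 , 2) ∷ [])
               ((0 , 1 , 2) ∷ (0 , 1 , 2) ∷ [])
  step : ∀ {n E F x y z} → RET n E F → (p : (x , y , z) ∈ F) →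
         RET (n + 3)
             ((n , suc n) ∷ (suc n , suc (suc n)) ∷ (n , suc (suc n)) ∷
              (n , y) ∷ (n , z) ∷ (suc n , x) ∷ (suc n , z) ∷
              (suc (suc n) , x) ∷ (suc (suc n) , y) ∷ E)
             ((n , suc n , suc (suc n)) ∷ (n , y , z) ∷ (suc n , x , z) ∷
              (suc (suc n) , x , y) ∷ (x , suc n , suc (suc n)) ∷
              (y , n , suc (suc n)) ∷ (z , n , suc n) ∷ (F ─ p))

Adj : List Edge → ℕ → ℕ → Set
Adj E u v = ((u , v) ∈ E) ⊎ ((v , u) ∈ E)

Adj? : (E : List Edge) → (u v : ℕ) → Dec (Adj E u v)
Adj? E u v = ((u , v) ∈? E) ⊎-dec ((v , u) ∈? E)

neighbours : ℕ → List Edge → ℕ → List ℕ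
neighbours n E v = filter (Adj? E v) (upTo n)

degree : ℕ → List Edge → ℕ → ℕ
degree n E v = length (neighbours n E v)

Coloring : ℕ → Set
Coloring k = ℕ → Fin k

Proper : ∀ {k} → ℕ → List Edge → Coloring k → Set
Proper n E c = ∀ u v → u < n → v < n → Adj E u v → c u ≢ c v

neighbourColours : ∀ {k} → ℕ → List Edge → Coloring k → ℕ → List (Fin k)
neighbourColours {k} n E c v =
  filter (λ i → any? (λ w → c w ≟F i) (neighbours n E v)) (allFin k)

Dynamic : ∀ {k} → ℕ → ℕ → List Edge → Coloring k → Set
Dynamic r n E c = Proper n E c ×
  (∀ v → v < n → r ⊓ degree n E v ≤ length (neighbourColours n E c v))

-- i ∈ L_G(u): color i appears nowhere on the closed neighbourhood of u
InL : ∀ {k} → ℕ → List Edge → Coloring k → ℕ → Fin k → Set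
InL n E c u i = c u ≢ i × (∀ w → w < n → Adj E u w → c w ≢ i)

SameL : ∀ {k} → ℕ → List Edge → Coloring k → ℕ → ℕ → Set
SameL n E c u v = ∀ i → (InL n E c u i → InL n E c v i) × (InL n E c v i → InL n E c u i)

{-# OPTIONS --safe #-}
module Submission where

-- Induction along the construction, carrying a proper 5-dynamic 6-colouring in which adjacent
-- degree-4 vertices have different free colours; a degree-4 vertex sees exactly four colours,
-- so it has exactly one free colour.  A step puts apexes a, b, c into the face xyz and gives
-- them the three colours A, B, C not used on x, y, z.  The only danger is a corner, say x, of
-- degree 4 that would still see only four colours; it sees B and C through b and c, so it is
-- enough that the apex a opposite x does not get the free colour of x.  Adjacent corners have
-- different free colours, so such an assignment exists.  Every apex has degree 4 and sees all
-- colours but that of its opposite corner, which is then its free colour; an adjacent apex sees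
-- that corner, hence has a different free colour.  The corners end with degree at least 6 and
-- all other old vertices keep their neighbourhoods.

open import Defs
open import Data.Nat using (ℕ; _<_; zero; suc; _+_; _≤_; _⊓_; z≤n; s≤s; z<s; _≟_; _<?_; _≤?_)
open import Data.List using (List; []; _∷_; _++_; length; map; lookup; allFin)
open import Data.Product using (Σ; _×_; _,_; proj₁; proj₂; ∃; swap)
import Data.Product as Product
open import Function using (_∘_)
open import Relation.Nullary using (¬_; yes; no; Dec; ¬?; contradiction)
open import Relation.Binary.PropositionalEquality using (_≡_; _≢_; refl; sym; trans; cong; subst; subst₂; ≢-sym)

open import Data.Nat.Properties using (≤-refl; ≤-trans; ≤-antisym; <-trans; <-≤-trans; ≤-reflexive; <⇒≱; +-cancelˡ-≤; n≤1+n; n<1+n; m≤m+n; m⊓n≤m; m≤n⇒m⊓n≡m; ≤∧≢⇒<; +-comm; allUpTo?)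
import Data.Nat.Properties as ℕ
open import Data.Nat.DivMod using (_mod_)
open import Data.Fin using (Fin)
open import Data.Fin.Patterns using (0F; 1F; 2F; 3F; 4F; 5F; 6F; 7F; 8F)
open import Data.Fin.Properties using (any?; all?) renaming (_≟_ to _≟ᶠ_)
open import Data.Sum using (_⊎_; inj₁; inj₂)
import Data.Sum as Sum
open import Data.Empty using (⊥-elim)
open import Data.List.Properties using (length-removeAt′; length-tabulate; length-map)
open import Data.List.Relation.Unary.Any using (here; there; index; _─_)
open import Data.List.Relation.Unary.Any.Properties using (lookup-index)
import Data.List.Relation.Unary.Any as Any
open import Data.List.Relation.Unary.All using (All; []; _∷_)
import Data.List.Relation.Unary.All as All
open import Data.List.Relation.Unary.All.Properties using (¬Any⇒All¬; ─⁺)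
open import Data.List.Relation.Unary.AllPairs using ([]; _∷_)
import Data.List.Relation.Unary.AllPairs as AllPairs
open import Data.List.Relation.Unary.Unique.DecPropositional (_≟ᶠ_ {6}) using (unique?)
open import Data.List.Relation.Unary.Unique.Propositional using (Unique)
open import Data.List.Relation.Unary.Unique.Propositional.Properties using (allFin⁺; map⁺; map⁻; filter⁺; upTo⁺)
open import Data.List.Membership.Propositional using (_∈_; _∉_; find; lose)
open import Data.List.Membership.Propositional.Properties using (∈-allFin; ∈-lookup; ∈-map⁺; ∈-filter⁺; ∈-filter⁻; ∈-upTo⁺; ∈-upTo⁻; ∈-++⁻; ∈-++⁺ˡ; ∈-++⁺ʳ; ∈-map⁻)
open import Data.List.Relation.Binary.Subset.Propositional using (_⊆_)
open import Relation.Nullary.Decidable using (decidable-stable; True; toWitness; map′; _×-dec_; _→-dec_)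

-- Counting with duplicate-free lists

∈-─⁺ : ∀ {A : Set} {x w : A} {ys : List A} (x∈ys : x ∈ ys) → w ∈ ys → w ≢ x → w ∈ (ys ─ x∈ys)
∈-─⁺ (here refl) (here refl) w≢x = contradiction refl w≢x
∈-─⁺ (here _)    (there w∈ys) _ = w∈ys
∈-─⁺ (there _)   (here refl) _ = here refl
∈-─⁺ (there x∈ys) (there w∈ys) w≢x = there (∈-─⁺ x∈ys w∈ys w≢x)

Unique-⊆⇒length≤ : ∀ {A : Set} {xs ys : List A} → Unique xs → xs ⊆ ys → length xs ≤ length ys
Unique-⊆⇒length≤ {xs = []} _ _ = z≤n
Unique-⊆⇒length≤ {xs = x ∷ xs} {ys} (x∉xs ∷ xs-unique) xs⊆ys =
  ≤-trans (s≤s (Unique-⊆⇒length≤ xs-unique xs⊆ys─x)) (≤-reflexive (sym (length-removeAt′ ys (index x∈ys))))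
  where
  x∈ys : x ∈ ys
  x∈ys = xs⊆ys (here refl)
  xs⊆ys─x : xs ⊆ (ys ─ x∈ys)
  xs⊆ys─x w∈xs = ∈-─⁺ x∈ys (xs⊆ys (there w∈xs)) (λ w≡x → All.lookup x∉xs w∈xs (sym w≡x))

Unique-lookup-injective : ∀ {A : Set} {xs : List A} → Unique xs → ∀ {i j} → lookup xs i ≡ lookup xs j → i ≡ j
Unique-lookup-injective (_ ∷ _) {Fin.zero} {Fin.zero} _ = refl
Unique-lookup-injective (x∉xs ∷ _) {Fin.zero} {Fin.suc j} eq = contradiction eq (All.lookup x∉xs (∈-lookup j))
Unique-lookup-injective (x∉xs ∷ _) {Fin.suc i} {Fin.zero} eq = contradiction (sym eq) (All.lookup x∉xs (∈-lookup i))
Unique-lookup-injective (_ ∷ xs-unique) {Fin.suc i} {Fin.suc j} eq = cong Fin.suc (Unique-lookup-injective xs-unique eq)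

length-allFin : ∀ k → length (allFin k) ≡ k
length-allFin k = length-tabulate {n = k} (λ i → i)

Unique⇒length≤ : ∀ {k} {xs : List (Fin k)} → Unique xs → length xs ≤ k
Unique⇒length≤ {k} xs-unique = ≤-trans (Unique-⊆⇒length≤ xs-unique (λ {i} _ → ∈-allFin i)) (≤-reflexive (length-allFin k))

-- Opaque because only its type is ever needed: unfolding the search blows up normal forms.
opaque
  fresh : ∀ {k} (xs : List (Fin k)) → length xs < k → ∃ λ i → i ∉ xs
  fresh {k} xs xs<k with any? (λ i → ¬? (Any.any? (i ≟ᶠ_) xs))
  ... | yes found = found
  ... | no none = contradiction (Unique-⊆⇒length≤ (allFin⁺ k) all∈xs) (<⇒≱ (<-≤-trans xs<k (≤-reflexive (sym (length-allFin k)))))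
    where
    all∈xs : allFin k ⊆ xs
    all∈xs {i} _ = decidable-stable (Any.any? (i ≟ᶠ_) xs) (λ i∉xs → none (i , i∉xs))

Unique-full⇒∈ : ∀ {k} {xs : List (Fin k)} → Unique xs → k ≤ length xs → ∀ i → i ∈ xs
Unique-full⇒∈ {xs = xs} xs-unique k≤xs i with Any.any? (i ≟ᶠ_) xs
... | yes i∈xs = i∈xs
... | no i∉xs = contradiction k≤xs (<⇒≱ (Unique⇒length≤ (¬Any⇒All¬ xs i∉xs ∷ xs-unique)))

∈-excluded : ∀ {A : Set} {t : A} xs {ys} → t ∈ xs ++ ys → All (t ≢_) xs → t ∈ ys
∈-excluded xs t∈ t∉xs = Sum.[ (λ t∈xs → contradiction refl (All.lookup t∉xs t∈xs)) , (λ t∈ys → t∈ys) ] (∈-++⁻ xs t∈)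

Unique-swap : ∀ {A : Set} {x y : A} {zs : List A} → Unique (x ∷ y ∷ zs) → Unique (y ∷ x ∷ zs)
Unique-swap ((x≢y ∷ x∉zs) ∷ y∉zs ∷ zs-unique) = (≢-sym x≢y ∷ y∉zs) ∷ x∉zs ∷ zs-unique

-- Neighbourhoods and the colours they see

Adj-sym : ∀ {E u v} → Adj E u v → Adj E v u
Adj-sym (inj₁ e) = inj₂ e
Adj-sym (inj₂ e) = inj₁ e

Adj-++⁻ : ∀ E₁ {E₂ u v} → Adj (E₁ ++ E₂) u v → Adj E₁ u v ⊎ Adj E₂ u v
Adj-++⁻ E₁ (inj₁ e) = Sum.map inj₁ inj₁ (∈-++⁻ E₁ e)
Adj-++⁻ E₁ (inj₂ e) = Sum.map inj₂ inj₂ (∈-++⁻ E₁ e)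

Adj-++⁺ʳ : ∀ E₁ {E₂ u v} → Adj E₂ u v → Adj (E₁ ++ E₂) u v
Adj-++⁺ʳ E₁ = Sum.map (∈-++⁺ʳ E₁) (∈-++⁺ʳ E₁)

BoundedEdge : ℕ → Edge → Set
BoundedEdge n (u , v) = u < n × v < n

Adj-bounded : ∀ {n E u v} → All (BoundedEdge n) E → Adj E u v → u < n × v < n
Adj-bounded bounded (inj₁ e) = All.lookup bounded e
Adj-bounded bounded (inj₂ e) = swap (All.lookup bounded e)

module Neighbourhood (n : ℕ) (E : List Edge) where

  ∈-neighbours⁺ : ∀ {v w} → w < n → Adj E v w → w ∈ neighbours n E v
  ∈-neighbours⁺ {v} w<n v~w = ∈-filter⁺ (Adj? E v) (∈-upTo⁺ w<n) v~w

  ∈-neighbours⁻ : ∀ {v w} → w ∈ neighbours n E v → w < n × Adj E v w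
  ∈-neighbours⁻ {v} w∈ = Product.map₁ ∈-upTo⁻ (∈-filter⁻ (Adj? E v) w∈)

  neighbours-unique : ∀ v → Unique (neighbours n E v)
  neighbours-unique v = filter⁺ (Adj? E v) (upTo⁺ n)

  degree≡length : ∀ {v} {N : List ℕ} → Unique N → (∀ {w} → Adj E v w → w ∈ N) →
                  All (λ w → w < n × Adj E v w) N → degree n E v ≡ length N
  degree≡length {v} N-unique exact adjacent = ≤-antisym
    (Unique-⊆⇒length≤ (neighbours-unique v) (λ w∈ → exact (proj₂ (∈-neighbours⁻ w∈))))
    (Unique-⊆⇒length≤ N-unique (λ w∈N → Product.uncurry ∈-neighbours⁺ (All.lookup adjacent w∈N)))

  module _ {k} (col : Coloring k) where

    ∈-neighbourColours⁺ : ∀ {v w} → w < n → Adj E v w → col w ∈ neighbourColours n E col v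
    ∈-neighbourColours⁺ {v} {w} w<n v~w =
      ∈-filter⁺ _ (∈-allFin (col w)) (lose (∈-neighbours⁺ w<n v~w) refl)

    ∈-neighbourColours⁻ : ∀ {v i} → i ∈ neighbourColours n E col v → ∃ λ w → (w < n × Adj E v w) × col w ≡ i
    ∈-neighbourColours⁻ {v} i∈
      with find (proj₂ (∈-filter⁻ (λ j → Any.any? (λ w → col w ≟ᶠ j) (neighbours n E v)) {xs = allFin k} i∈))
    ... | w , w∈ , cw≡i = w , ∈-neighbours⁻ w∈ , cw≡i

    neighbourColours-unique : ∀ v → Unique (neighbourColours n E col v)
    neighbourColours-unique v = filter⁺ (λ j → Any.any? (λ w → col w ≟ᶠ j) (neighbours n E v)) (allFin⁺ k)

    neighbourColours≤degree : ∀ v → length (neighbourColours n E col v) ≤ degree n E v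
    neighbourColours≤degree v =
      ≤-trans (Unique-⊆⇒length≤ (neighbourColours-unique v) ⊆colours) (≤-reflexive (length-map col (neighbours n E v)))
      where
      ⊆colours : neighbourColours n E col v ⊆ map col (neighbours n E v)
      ⊆colours i∈ with ∈-neighbourColours⁻ i∈
      ... | w , (w<n , v~w) , refl = ∈-map⁺ col (∈-neighbours⁺ w<n v~w)

    InL⇒∉neighbourColours : ∀ {v i} → InL n E col v i → i ∉ neighbourColours n E col v
    InL⇒∉neighbourColours (_ , unseen) i∈ with ∈-neighbourColours⁻ i∈
    ... | w , (w<n , v~w) , cw≡i = unseen w w<n v~w cw≡i

module _ {n n′ : ℕ} {E E′ : List Edge} (n≤n′ : n ≤ n′) (E⊆E′ : ∀ {u w} → Adj E u w → Adj E′ u w) where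

  private
    module N = Neighbourhood n E
    module N′ = Neighbourhood n′ E′

  degree-mono : ∀ v → degree n E v ≤ degree n′ E′ v
  degree-mono v = Unique-⊆⇒length≤ (N.neighbours-unique v) grow
    where
    grow : neighbours n E v ⊆ neighbours n′ E′ v
    grow w∈ with N.∈-neighbours⁻ w∈
    ... | w<n , v~w = N′.∈-neighbours⁺ (<-≤-trans w<n n≤n′) (E⊆E′ v~w)

  neighbourColours-mono : ∀ {k} {col col′ : Coloring k} → (∀ {w} → w < n → col′ w ≡ col w) →
                          ∀ v → neighbourColours n E col v ⊆ neighbourColours n′ E′ col′ v
  neighbourColours-mono {col = col} {col′} col′≡col v i∈ with N.∈-neighbourColours⁻ col i∈
  ... | w , (w<n , v~w) , refl =
    subst (_∈ neighbourColours n′ E′ col′ v) (col′≡col w<n)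
      (N′.∈-neighbourColours⁺ col′ (<-≤-trans w<n n≤n′) (E⊆E′ v~w))

-- Free colours

Colour : Set
Colour = Fin 6

Separating : ℕ → List Edge → Coloring 6 → Set
Separating n E col = ∀ u v → u < n → v < n → Adj E u v →
  degree n E u ≡ 4 → degree n E v ≡ 4 → ¬ SameL n E col u v

GoodColouring : ℕ → List Edge → Coloring 6 → Set
GoodColouring n E col = Dynamic 5 n E col × Separating n E col

FreeColour : ℕ → List Edge → Coloring 6 → ℕ → Set
FreeColour n E col v = ∃ λ ℓ → InL n E col v ℓ × (∀ i → InL n E col v i → i ≡ ℓ)

same-free-colour⇒SameL : ∀ {n E col u v} ((ℓ , _) : FreeColour n E col u) ((ℓ′ , _) : FreeColour n E col v) →
                         ℓ ≡ ℓ′ → SameL n E col u v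
same-free-colour⇒SameL {n} {E} {col} {u} {v} (ℓ , ℓ-free-u , only-ℓ-u) (ℓ , ℓ-free-v , only-ℓ-v) refl i =
  (λ i-free → subst (InL n E col v) (sym (only-ℓ-u i i-free)) ℓ-free-v) ,
  (λ i-free → subst (InL n E col u) (sym (only-ℓ-v i i-free)) ℓ-free-u)

module Forbidden {n : ℕ} {E : List Edge} {col : Coloring 6} (good : GoodColouring n E col) where

  open Neighbourhood n E

  private
    proper : Proper n E col
    proper = proj₁ (proj₁ good)
    dynamic : ∀ v → v < n → 5 ⊓ degree n E v ≤ length (neighbourColours n E col v)
    dynamic = proj₂ (proj₁ good)
    separating : Separating n E col
    separating = proj₂ good

  free-colour : ∀ {v} → v < n → degree n E v ≡ 4 → FreeColour n E col v
  free-colour {v} v<n d≡4 = ℓ , ℓ-free , only-ℓ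
    where
    cs : List Colour
    cs = neighbourColours n E col v
    4≤cs : 4 ≤ length cs
    4≤cs = subst (λ d → 5 ⊓ d ≤ length cs) d≡4 (dynamic v v<n)
    own∉cs : col v ∉ cs
    own∉cs i∈ with ∈-neighbourColours⁻ col i∈
    ... | w , (w<n , v~w) , cw≡cv = proper v w v<n w<n v~w (sym cw≡cv)
    ℓ-fresh : ∃ λ ℓ → ℓ ∉ col v ∷ cs
    ℓ-fresh = fresh (col v ∷ cs) (s≤s (s≤s (subst (length cs ≤_) d≡4 (neighbourColours≤degree col v))))
    ℓ : Colour
    ℓ = proj₁ ℓ-fresh
    ℓ-free : InL n E col v ℓ
    ℓ-free = (λ cv≡ℓ → proj₂ ℓ-fresh (here (sym cv≡ℓ))) ,
             (λ w w<n v~w cw≡ℓ → proj₂ ℓ-fresh (there (subst (_∈ cs) cw≡ℓ (∈-neighbourColours⁺ col w<n v~w))))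
    only-ℓ : ∀ i → InL n E col v i → i ≡ ℓ
    only-ℓ i i-free with i ≟ᶠ ℓ
    ... | yes i≡ℓ = i≡ℓ
    ... | no i≢ℓ = contradiction (+-cancelˡ-≤ 3 _ _ (Unique⇒length≤ seven-distinct)) (<⇒≱ 4≤cs)
      where
      seven-distinct : Unique (i ∷ ℓ ∷ col v ∷ cs)
      seven-distinct = (i≢ℓ ∷ ≢-sym (proj₁ i-free) ∷ ¬Any⇒All¬ cs (InL⇒∉neighbourColours col i-free))
                     ∷ ¬Any⇒All¬ (col v ∷ cs) (proj₂ ℓ-fresh) ∷ ¬Any⇒All¬ cs own∉cs ∷ neighbourColours-unique col v

  -- The colour the apex opposite v must avoid: the free colour of v if v has degree 4, and
  -- otherwise v's own colour, which keeps the colours chosen for adjacent vertices distinct.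
  forbidden : ∀ v → v < n → Colour
  forbidden v v<n with degree n E v ≟ 4
  ... | yes d≡4 = proj₁ (free-colour v<n d≡4)
  ... | no _ = col v

  forbidden-free : ∀ {v} (v<n : v < n) → degree n E v ≡ 4 → InL n E col v (forbidden v v<n)
  forbidden-free {v} v<n d≡4 with degree n E v ≟ 4
  ... | yes d≡4′ = proj₁ (proj₂ (free-colour v<n d≡4′))
  ... | no d≢4 = contradiction d≡4 d≢4

  forbidden-distinct : ∀ {u v} (u<n : u < n) (v<n : v < n) → Adj E u v → forbidden u u<n ≢ forbidden v v<n
  forbidden-distinct {u} {v} u<n v<n u~v with degree n E u ≟ 4 | degree n E v ≟ 4
  ... | yes du | yes dv = separating u v u<n v<n u~v du dv ∘ same-free-colour⇒SameL (free-colour u<n du) (free-colour v<n dv)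
  ... | yes du | no _ = λ ℓ≡cv → proj₂ (proj₁ (proj₂ (free-colour u<n du))) v v<n u~v (sym ℓ≡cv)
  ... | no _ | yes dv = proj₂ (proj₁ (proj₂ (free-colour v<n dv))) u u<n (Adj-sym u~v)
  ... | no _ | no _ = proper u v u<n v<n u~v

record Palette (X Y Z fx fy fz : Colour) : Set where
  field
    A B C : Colour
    distinct : Unique (A ∷ B ∷ C ∷ X ∷ Y ∷ Z ∷ [])
    fx≢A : fx ≢ A
    fy≢B : fy ≢ B
    fz≢C : fz ≢ C

-- C avoids fz; the remaining two colours go to a and b in whichever order avoids fx and fy,
-- which one of the two orders does because fx ≢ fy.
palette : ∀ {X Y Z fx fy fz} → Unique (X ∷ Y ∷ Z ∷ []) → fx ≢ fy → Palette X Y Z fx fy fz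
palette {X} {Y} {Z} {fx} {fy} {fz} XYZ-distinct fx≢fy = choose (fx ≟ᶠ P) (fy ≟ᶠ Q)
  where
  C-fresh : ∃ λ C → C ∉ fz ∷ X ∷ Y ∷ Z ∷ []
  C-fresh = fresh _ (n≤1+n 5)
  C : Colour
  C = proj₁ C-fresh
  Q-fresh : ∃ λ Q → Q ∉ C ∷ X ∷ Y ∷ Z ∷ []
  Q-fresh = fresh _ (n≤1+n 5)
  Q : Colour
  Q = proj₁ Q-fresh
  P-fresh : ∃ λ P → P ∉ Q ∷ C ∷ X ∷ Y ∷ Z ∷ []
  P-fresh = fresh _ (n<1+n 5)
  P : Colour
  P = proj₁ P-fresh
  P≢Q : P ≢ Q
  P≢Q P≡Q = proj₂ P-fresh (here P≡Q)
  PQC-distinct : Unique (P ∷ Q ∷ C ∷ X ∷ Y ∷ Z ∷ [])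
  PQC-distinct = ¬Any⇒All¬ _ (proj₂ P-fresh) ∷ ¬Any⇒All¬ _ (proj₂ Q-fresh)
               ∷ ¬Any⇒All¬ _ (proj₂ C-fresh ∘ there) ∷ XYZ-distinct
  fz≢C : fz ≢ C
  fz≢C fz≡C = proj₂ C-fresh (here (sym fz≡C))
  straight : fx ≢ P → fy ≢ Q → Palette X Y Z fx fy fz
  straight fx≢P fy≢Q =
    record { A = P ; B = Q ; C = C ; distinct = PQC-distinct ; fx≢A = fx≢P ; fy≢B = fy≢Q ; fz≢C = fz≢C }
  swapped : fx ≢ Q → fy ≢ P → Palette X Y Z fx fy fz
  swapped fx≢Q fy≢P =
    record { A = Q ; B = P ; C = C ; distinct = Unique-swap PQC-distinct ; fx≢A = fx≢Q ; fy≢B = fy≢P ; fz≢C = fz≢C }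
  choose : Dec (fx ≡ P) → Dec (fy ≡ Q) → Palette X Y Z fx fy fz
  choose (yes fx≡P) _ =
    swapped (λ fx≡Q → P≢Q (trans (sym fx≡P) fx≡Q)) (λ fy≡P → fx≢fy (trans fx≡P (sym fy≡P)))
  choose (no _) (yes fy≡Q) =
    swapped (λ fx≡Q → fx≢fy (trans fx≡Q (sym fy≡Q))) (λ fy≡P → P≢Q (trans (sym fy≡P) fy≡Q))
  choose (no fx≢P) (no fy≢Q) = straight fx≢P fy≢Q

-- One step of the construction

-- The colouring col on 0, …, n - 1 followed by A, B, C (and junk C beyond n + 2).
extend : ∀ {k} → ℕ → Coloring k → Fin k → Fin k → Fin k → Coloring k
extend zero    col A B C zero          = A
extend zero    col A B C (suc zero)    = B
extend zero    col A B C (suc (suc _)) = C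
extend (suc n) col A B C zero          = col zero
extend (suc n) col A B C (suc v)       = extend n (col ∘ suc) A B C v

module _ {k} {A B C : Fin k} where

  extend-old : ∀ {n v} (col : Coloring k) → v < n → extend n col A B C v ≡ col v
  extend-old {suc n} {zero} col _ = refl
  extend-old {suc n} {suc v} col (s≤s v<n) = extend-old (col ∘ suc) v<n

  extend-n : ∀ n (col : Coloring k) → extend n col A B C n ≡ A
  extend-n zero col = refl
  extend-n (suc n) col = extend-n n (col ∘ suc)

  extend-1+n : ∀ n (col : Coloring k) → extend n col A B C (suc n) ≡ B
  extend-1+n zero col = refl
  extend-1+n (suc n) col = extend-1+n n (col ∘ suc)

  extend-2+n : ∀ n (col : Coloring k) → extend n col A B C (suc (suc n)) ≡ C
  extend-2+n zero col = refl
  extend-2+n (suc n) col = extend-2+n n (col ∘ suc)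

<+3-split : ∀ n {v} → v < n + 3 → v < n ⊎ v ≡ n ⊎ v ≡ suc n ⊎ v ≡ suc (suc n)
<+3-split zero {0} _ = inj₂ (inj₁ refl)
<+3-split zero {1} _ = inj₂ (inj₂ (inj₁ refl))
<+3-split zero {2} _ = inj₂ (inj₂ (inj₂ refl))
<+3-split zero {suc (suc (suc _))} (s≤s (s≤s (s≤s ())))
<+3-split (suc n) {zero} _ = inj₁ z<s
<+3-split (suc n) {suc v} (s≤s v<n+3) =
  Sum.map s≤s (Sum.map (cong suc) (Sum.map (cong suc) (cong suc))) (<+3-split n v<n+3)

newEdges : ℕ → ℕ → ℕ → ℕ → List Edge
newEdges n x y z = (a , b) ∷ (b , c) ∷ (a , c) ∷ (a , y) ∷ (a , z) ∷ (b , x) ∷ (b , z) ∷ (c , x) ∷ (c , y) ∷ []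
  where
  a b c : ℕ
  a = n
  b = suc n
  c = suc (suc n)

newFaces : ℕ → ℕ → ℕ → ℕ → List Face
newFaces n x y z = (a , b , c) ∷ (a , y , z) ∷ (b , x , z) ∷ (c , x , y) ∷ (x , b , c) ∷ (y , a , c) ∷ (z , a , b) ∷ []
  where
  a b c : ℕ
  a = n
  b = suc n
  c = suc (suc n)

record Triangle (n : ℕ) (E : List Edge) (x y z : ℕ) : Set where
  constructor triangle
  field
    x<n : x < n
    y<n : y < n
    z<n : z < n
    x~y : Adj E x y
    y~z : Adj E y z
    x~z : Adj E x z

FaceTriangle : ℕ → List Edge → Face → Set
FaceTriangle n E (x , y , z) = Triangle n E x y z

record WellFormed (n : ℕ) (E : List Edge) (F : List Face) : Set where
  constructor wellFormed
  field
    edges-bounded : All (BoundedEdge n) E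
    faces-triangles : All (FaceTriangle n E) F
    degree≥4 : ∀ v → v < n → 4 ≤ degree n E v

record Certified (n : ℕ) (E : List Edge) (F : List Face) : Set where
  constructor certified
  field
    well-formed : WellFormed n E F
    colouring : Coloring 6
    good : GoodColouring n E colouring

module Step {n : ℕ} {E : List Edge} {F : List Face} {x y z : ℕ} {col : Coloring 6}
            (wf : WellFormed n E F) (good : GoodColouring n E col) (xyz∈F : (x , y , z) ∈ F) where

  open WellFormed wf
  open Triangle (All.lookup faces-triangles xyz∈F)

  a b c n⁺ : ℕ
  a = n
  b = suc n
  c = suc (suc n)
  n⁺ = n + 3

  E⁺ : List Edge
  E⁺ = newEdges n x y z ++ E

  F⁺ : List Face
  F⁺ = newFaces n x y z ++ (F ─ xyz∈F)

  corners : List ℕ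
  corners = x ∷ y ∷ z ∷ []

  module N = Neighbourhood n E
  module N⁺ = Neighbourhood n⁺ E⁺

  n≤b : n ≤ b
  n≤b = n≤1+n n

  n≤c : n ≤ c
  n≤c = ≤-trans n≤b (n≤1+n b)

  n≤n⁺ : n ≤ n⁺
  n≤n⁺ = m≤m+n n 3

  c<n⁺ : c < n⁺
  c<n⁺ = subst (c <_) (+-comm 3 n) ≤-refl

  b<n⁺ : b < n⁺
  b<n⁺ = <-trans (n<1+n b) c<n⁺

  a<n⁺ : a < n⁺
  a<n⁺ = <-trans (n<1+n a) b<n⁺

  old<n⁺ : ∀ {v} → v < n → v < n⁺
  old<n⁺ v<n = <-≤-trans v<n n≤n⁺

  old⊆E⁺ : ∀ {u w} → Adj E u w → Adj E⁺ u w
  old⊆E⁺ = Adj-++⁺ʳ (newEdges n x y z)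

  new∈E⁺ : (i : Fin 9) → lookup (newEdges n x y z) i ∈ E⁺
  new∈E⁺ i = ∈-++⁺ˡ (∈-lookup {xs = newEdges n x y z} i)

  a~b : Adj E⁺ a b
  a~b = inj₁ (new∈E⁺ 0F)
  b~c : Adj E⁺ b c
  b~c = inj₁ (new∈E⁺ 1F)
  a~c : Adj E⁺ a c
  a~c = inj₁ (new∈E⁺ 2F)
  a~y : Adj E⁺ a y
  a~y = inj₁ (new∈E⁺ 3F)
  a~z : Adj E⁺ a z
  a~z = inj₁ (new∈E⁺ 4F)
  b~x : Adj E⁺ b x
  b~x = inj₁ (new∈E⁺ 5F)
  b~z : Adj E⁺ b z
  b~z = inj₁ (new∈E⁺ 6F)
  c~x : Adj E⁺ c x
  c~x = inj₁ (new∈E⁺ 7F)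
  c~y : Adj E⁺ c y
  c~y = inj₁ (new∈E⁺ 8F)

  by-vertex : ∀ (P : ℕ → Set) → (∀ {v} → v < n → P v) → P a → P b → P c → ∀ {v} → v < n⁺ → P v
  by-vertex P old pa pb pc {v} v<n⁺ with <+3-split n v<n⁺
  ... | inj₁ v<n = old v<n
  ... | inj₂ (inj₁ refl) = pa
  ... | inj₂ (inj₂ (inj₁ refl)) = pb
  ... | inj₂ (inj₂ (inj₂ refl)) = pc

  newEdges-shape : All (λ e → n ≤ proj₁ e × (n ≤ proj₂ e ⊎ proj₂ e ∈ corners)) (newEdges n x y z)
  newEdges-shape = (≤-refl , inj₁ n≤b) ∷ (n≤b , inj₁ n≤c) ∷ (≤-refl , inj₁ n≤c)
                 ∷ (≤-refl , inj₂ (there (here refl))) ∷ (≤-refl , inj₂ (there (there (here refl))))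
                 ∷ (n≤b , inj₂ (here refl)) ∷ (n≤b , inj₂ (there (there (here refl))))
                 ∷ (n≤c , inj₂ (here refl)) ∷ (n≤c , inj₂ (there (here refl))) ∷ []

  new-not-old : ∀ {v} → n ≤ v → ¬ v < n
  new-not-old n≤v v<n = <⇒≱ v<n n≤v

  old-adjacency : ∀ {u w} → u < n → Adj E⁺ u w → Adj E u w ⊎ (u ∈ corners × n ≤ w)
  old-adjacency u<n u~w with Adj-++⁻ (newEdges n x y z) u~w
  ... | inj₂ old = inj₁ old
  ... | inj₁ (inj₁ e) = ⊥-elim (new-not-old (proj₁ (All.lookup newEdges-shape e)) u<n)
  ... | inj₁ (inj₂ e) with All.lookup newEdges-shape e
  ...   | _ , inj₁ n≤u = ⊥-elim (new-not-old n≤u u<n)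
  ...   | n≤w , inj₂ u∈corners = inj₂ (u∈corners , n≤w)

  non-corner-adjacency : ∀ {u w} → u < n → u ∉ corners → Adj E⁺ u w → Adj E u w
  non-corner-adjacency u<n u∉corners u~w with old-adjacency u<n u~w
  ... | inj₁ old = old
  ... | inj₂ (u∈corners , _) = contradiction u∈corners u∉corners

  a-neighbours : ∀ {w} → Adj E⁺ a w → w ∈ b ∷ c ∷ y ∷ z ∷ []
  a-neighbours a~w with Adj-++⁻ (newEdges n x y z) a~w
  ... | inj₂ old = ⊥-elim (new-not-old ≤-refl (proj₁ (Adj-bounded edges-bounded old)))
  ... | inj₁ (inj₁ e) with index e | lookup-index e
  ...   | 0F | refl = here refl
  ...   | 2F | refl = there (here refl)
  ...   | 3F | refl = there (there (here refl))
  ...   | 4F | refl = there (there (there (here refl)))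
  ...   | 1F | ()
  ...   | 5F | ()
  ...   | 6F | ()
  ...   | 7F | ()
  ...   | 8F | ()
  a-neighbours _ | inj₁ (inj₂ e) with index e | lookup-index e
  ...   | 0F | ()
  ...   | 1F | ()
  ...   | 2F | ()
  ...   | 3F | refl = ⊥-elim (new-not-old ≤-refl y<n)
  ...   | 4F | refl = ⊥-elim (new-not-old ≤-refl z<n)
  ...   | 5F | refl = ⊥-elim (new-not-old ≤-refl x<n)
  ...   | 6F | refl = ⊥-elim (new-not-old ≤-refl z<n)
  ...   | 7F | refl = ⊥-elim (new-not-old ≤-refl x<n)
  ...   | 8F | refl = ⊥-elim (new-not-old ≤-refl y<n)

  b-neighbours : ∀ {w} → Adj E⁺ b w → w ∈ a ∷ c ∷ x ∷ z ∷ []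
  b-neighbours b~w with Adj-++⁻ (newEdges n x y z) b~w
  ... | inj₂ old = ⊥-elim (new-not-old n≤b (proj₁ (Adj-bounded edges-bounded old)))
  ... | inj₁ (inj₁ e) with index e | lookup-index e
  ...   | 1F | refl = there (here refl)
  ...   | 5F | refl = there (there (here refl))
  ...   | 6F | refl = there (there (there (here refl)))
  ...   | 0F | ()
  ...   | 2F | ()
  ...   | 3F | ()
  ...   | 4F | ()
  ...   | 7F | ()
  ...   | 8F | ()
  b-neighbours _ | inj₁ (inj₂ e) with index e | lookup-index e
  ...   | 0F | refl = here refl
  ...   | 1F | ()
  ...   | 2F | ()
  ...   | 3F | refl = ⊥-elim (new-not-old n≤b y<n)
  ...   | 4F | refl = ⊥-elim (new-not-old n≤b z<n)
  ...   | 5F | refl = ⊥-elim (new-not-old n≤b x<n)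
  ...   | 6F | refl = ⊥-elim (new-not-old n≤b z<n)
  ...   | 7F | refl = ⊥-elim (new-not-old n≤b x<n)
  ...   | 8F | refl = ⊥-elim (new-not-old n≤b y<n)

  c-neighbours : ∀ {w} → Adj E⁺ c w → w ∈ a ∷ b ∷ x ∷ y ∷ []
  c-neighbours c~w with Adj-++⁻ (newEdges n x y z) c~w
  ... | inj₂ old = ⊥-elim (new-not-old n≤c (proj₁ (Adj-bounded edges-bounded old)))
  ... | inj₁ (inj₁ e) with index e | lookup-index e
  ...   | 7F | refl = there (there (here refl))
  ...   | 8F | refl = there (there (there (here refl)))
  ...   | 0F | ()
  ...   | 1F | ()
  ...   | 2F | ()
  ...   | 3F | ()
  ...   | 4F | ()
  ...   | 5F | ()
  ...   | 6F | ()
  c-neighbours _ | inj₁ (inj₂ e) with index e | lookup-index e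
  ...   | 0F | ()
  ...   | 1F | refl = there (here refl)
  ...   | 2F | refl = here refl
  ...   | 3F | refl = ⊥-elim (new-not-old n≤c y<n)
  ...   | 4F | refl = ⊥-elim (new-not-old n≤c z<n)
  ...   | 5F | refl = ⊥-elim (new-not-old n≤c x<n)
  ...   | 6F | refl = ⊥-elim (new-not-old n≤c z<n)
  ...   | 7F | refl = ⊥-elim (new-not-old n≤c x<n)
  ...   | 8F | refl = ⊥-elim (new-not-old n≤c y<n)

  corner-degree : ∀ {u w₁ w₂} → u < n → n ≤ w₁ → w₁ < w₂ → w₂ < n⁺ → Adj E⁺ u w₁ → Adj E⁺ u w₂ →
                  6 ≤ degree n⁺ E⁺ u
  corner-degree {u} {w₁} {w₂} u<n n≤w₁ w₁<w₂ w₂<n⁺ u~w₁ u~w₂ =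
    ≤-trans (s≤s (s≤s (degree≥4 u u<n))) (Unique-⊆⇒length≤ distinct ⊆neighbours⁺)
    where
    new∉neighbours : ∀ {w} → n ≤ w → w ∉ neighbours n E u
    new∉neighbours n≤w w∈ = new-not-old n≤w (proj₁ (N.∈-neighbours⁻ w∈))
    n≤w₂ : n ≤ w₂
    n≤w₂ = ≤-trans n≤w₁ (ℕ.<⇒≤ w₁<w₂)
    distinct : Unique (w₁ ∷ w₂ ∷ neighbours n E u)
    distinct = (ℕ.<⇒≢ w₁<w₂ ∷ ¬Any⇒All¬ _ (new∉neighbours n≤w₁)) ∷ ¬Any⇒All¬ _ (new∉neighbours n≤w₂)
             ∷ N.neighbours-unique u
    ⊆neighbours⁺ : w₁ ∷ w₂ ∷ neighbours n E u ⊆ neighbours n⁺ E⁺ u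
    ⊆neighbours⁺ (here refl) = N⁺.∈-neighbours⁺ (<-trans w₁<w₂ w₂<n⁺) u~w₁
    ⊆neighbours⁺ (there (here refl)) = N⁺.∈-neighbours⁺ w₂<n⁺ u~w₂
    ⊆neighbours⁺ (there (there w∈)) with N.∈-neighbours⁻ w∈
    ... | w<n , u~w = N⁺.∈-neighbours⁺ (old<n⁺ w<n) (old⊆E⁺ u~w)

  corner-degree≥6 : ∀ {u} → u ∈ corners → 6 ≤ degree n⁺ E⁺ u
  corner-degree≥6 (here refl) = corner-degree x<n n≤b (n<1+n b) c<n⁺ (Adj-sym b~x) (Adj-sym c~x)
  corner-degree≥6 (there (here refl)) = corner-degree y<n ≤-refl (<-trans (n<1+n a) (n<1+n b)) c<n⁺ (Adj-sym a~y) (Adj-sym c~y)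
  corner-degree≥6 (there (there (here refl))) = corner-degree z<n ≤-refl (n<1+n a) b<n⁺ (Adj-sym a~z) (Adj-sym b~z)

  degree⁺≡4⇒∉corners : ∀ {u} → degree n⁺ E⁺ u ≡ 4 → u ∉ corners
  degree⁺≡4⇒∉corners d≡4 u∈corners with subst (6 ≤_) d≡4 (corner-degree≥6 u∈corners)
  ... | s≤s (s≤s (s≤s (s≤s ())))

  non-corner-degree : ∀ {u} → u < n → u ∉ corners → degree n⁺ E⁺ u ≡ degree n E u
  non-corner-degree {u} u<n u∉corners =
    ≤-antisym (Unique-⊆⇒length≤ (N⁺.neighbours-unique u) shrink) (degree-mono n≤n⁺ old⊆E⁺ u)
    where
    shrink : neighbours n⁺ E⁺ u ⊆ neighbours n E u
    shrink w∈ with non-corner-adjacency u<n u∉corners (proj₂ (N⁺.∈-neighbours⁻ w∈))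
    ... | u~w = N.∈-neighbours⁺ (proj₂ (Adj-bounded edges-bounded u~w)) u~w

  edges⁺-bounded : All (BoundedEdge n⁺) E⁺
  edges⁺-bounded = (a<n⁺ , b<n⁺) ∷ (b<n⁺ , c<n⁺) ∷ (a<n⁺ , c<n⁺) ∷ (a<n⁺ , old<n⁺ y<n) ∷ (a<n⁺ , old<n⁺ z<n)
                 ∷ (b<n⁺ , old<n⁺ x<n) ∷ (b<n⁺ , old<n⁺ z<n) ∷ (c<n⁺ , old<n⁺ x<n) ∷ (c<n⁺ , old<n⁺ y<n)
                 ∷ All.map (Product.map old<n⁺ old<n⁺) edges-bounded

  faces⁺-triangles : All (FaceTriangle n⁺ E⁺) F⁺
  faces⁺-triangles = triangle a<n⁺ b<n⁺ c<n⁺ a~b b~c a~c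
                   ∷ triangle a<n⁺ y<n⁺ z<n⁺ a~y (old⊆E⁺ y~z) a~z
                   ∷ triangle b<n⁺ x<n⁺ z<n⁺ b~x (old⊆E⁺ x~z) b~z
                   ∷ triangle c<n⁺ x<n⁺ y<n⁺ c~x (old⊆E⁺ x~y) c~y
                   ∷ triangle x<n⁺ b<n⁺ c<n⁺ (Adj-sym b~x) b~c (Adj-sym c~x)
                   ∷ triangle y<n⁺ a<n⁺ c<n⁺ (Adj-sym a~y) a~c (Adj-sym c~y)
                   ∷ triangle z<n⁺ a<n⁺ b<n⁺ (Adj-sym a~z) a~b (Adj-sym b~z)
                   ∷ All.map lift (─⁺ xyz∈F faces-triangles)
    where
    x<n⁺ : x < n⁺
    x<n⁺ = old<n⁺ x<n
    y<n⁺ : y < n⁺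
    y<n⁺ = old<n⁺ y<n
    z<n⁺ : z < n⁺
    z<n⁺ = old<n⁺ z<n
    lift : ∀ {f} → FaceTriangle n E f → FaceTriangle n⁺ E⁺ f
    lift (triangle u<n v<n w<n u~v v~w u~w) =
      triangle (old<n⁺ u<n) (old<n⁺ v<n) (old<n⁺ w<n) (old⊆E⁺ u~v) (old⊆E⁺ v~w) (old⊆E⁺ u~w)

  open Forbidden good

  private
    proper : Proper n E col
    proper = proj₁ (proj₁ good)
    dynamic : ∀ v → v < n → 5 ⊓ degree n E v ≤ length (neighbourColours n E col v)
    dynamic = proj₂ (proj₁ good)
    separating : Separating n E col
    separating = proj₂ good

  X Y Z : Colour
  X = col x
  Y = col y
  Z = col z

  XYZ-distinct : Unique (X ∷ Y ∷ Z ∷ [])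
  XYZ-distinct = (proper x y x<n y<n x~y ∷ proper x z x<n z<n x~z ∷ []) ∷ (proper y z y<n z<n y~z ∷ []) ∷ [] ∷ []

  fx fy fz : Colour
  fx = forbidden x x<n
  fy = forbidden y y<n
  fz = forbidden z z<n

  open Palette (palette {fz = fz} XYZ-distinct (forbidden-distinct x<n y<n x~y))

  col⁺ : Coloring 6
  col⁺ = extend n col A B C

  colour-old : ∀ {v} → v < n → col⁺ v ≡ col v
  colour-old = extend-old col

  colour-a : col⁺ a ≡ A
  colour-a = extend-n n col

  colour-b : col⁺ b ≡ B
  colour-b = extend-1+n n col

  colour-c : col⁺ c ≡ C
  colour-c = extend-2+n n col

  colours colours⁺ : ℕ → List Colour
  colours = neighbourColours n E col
  colours⁺ = neighbourColours n⁺ E⁺ col⁺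

  reorder : (is : List (Fin 6)) → {True (unique? is)} → Unique (map (lookup (A ∷ B ∷ C ∷ X ∷ Y ∷ Z ∷ [])) is)
  reorder is {is-distinct} = map⁺ (Unique-lookup-injective distinct) (toWitness is-distinct)

  recoloured : ∀ {m} {v₁ v₂ v₃ v₄ v₅ : ℕ} {C₁ C₂ C₃ C₄ C₅ : Colour} →
               col⁺ v₁ ≡ C₁ → col⁺ v₂ ≡ C₂ → col⁺ v₃ ≡ C₃ → col⁺ v₄ ≡ C₄ → col⁺ v₅ ≡ C₅ →
               Unique (m ∷ C₁ ∷ C₂ ∷ C₃ ∷ C₄ ∷ C₅ ∷ []) →
               Unique (m ∷ col⁺ v₁ ∷ col⁺ v₂ ∷ col⁺ v₃ ∷ col⁺ v₄ ∷ col⁺ v₅ ∷ [])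
  recoloured refl refl refl refl refl distinct = distinct

  module Apex {v : ℕ} {N : List ℕ} {m : Colour} (exact : ∀ {w} → Adj E⁺ v w → w ∈ N)
              (adjacent : All (λ w → w < n⁺ × Adj E⁺ v w) N) (closed-distinct : Unique (m ∷ col⁺ v ∷ map col⁺ N)) where

    private
      N-colours-distinct : Unique (map col⁺ N)
      N-colours-distinct = AllPairs.tail (AllPairs.tail closed-distinct)

    apex-degree : degree n⁺ E⁺ v ≡ length N
    apex-degree = N⁺.degree≡length (map⁻ N-colours-distinct) exact adjacent

    apex-dynamic : 5 ⊓ degree n⁺ E⁺ v ≤ length (colours⁺ v)
    apex-dynamic = subst (λ d → 5 ⊓ d ≤ length (colours⁺ v)) (sym apex-degree)
      (≤-trans (ℕ.m⊓n≤n 5 (length N))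
        (subst (_≤ length (colours⁺ v)) (length-map col⁺ N) (Unique-⊆⇒length≤ N-colours-distinct seen)))
      where
      seen : map col⁺ N ⊆ colours⁺ v
      seen i∈ = let (w , w∈N , i≡cw) = ∈-map⁻ col⁺ i∈ in
        subst (_∈ colours⁺ v) (sym i≡cw) (Product.uncurry (N⁺.∈-neighbourColours⁺ col⁺) (All.lookup adjacent w∈N))

    apex-proper : ∀ {w} → Adj E⁺ v w → col⁺ v ≢ col⁺ w
    apex-proper v~w = All.lookup (AllPairs.head (AllPairs.tail closed-distinct)) (∈-map⁺ col⁺ (exact v~w))

    apex-free : InL n⁺ E⁺ col⁺ v m
    apex-free = ≢-sym (All.head (AllPairs.head closed-distinct)) ,
                λ w _ v~w → ≢-sym (All.lookup (AllPairs.head closed-distinct) (there (∈-map⁺ col⁺ (exact v~w))))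

  -- Around each apex all colours appear except that of the opposite corner.
  a-closed : Unique (X ∷ col⁺ a ∷ col⁺ b ∷ col⁺ c ∷ col⁺ y ∷ col⁺ z ∷ [])
  a-closed = recoloured colour-a colour-b colour-c (colour-old y<n) (colour-old z<n) (reorder (3F ∷ 0F ∷ 1F ∷ 2F ∷ 4F ∷ 5F ∷ []))

  b-closed : Unique (Y ∷ col⁺ b ∷ col⁺ a ∷ col⁺ c ∷ col⁺ x ∷ col⁺ z ∷ [])
  b-closed = recoloured colour-b colour-a colour-c (colour-old x<n) (colour-old z<n) (reorder (4F ∷ 1F ∷ 0F ∷ 2F ∷ 3F ∷ 5F ∷ []))

  c-closed : Unique (Z ∷ col⁺ c ∷ col⁺ a ∷ col⁺ b ∷ col⁺ x ∷ col⁺ y ∷ [])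
  c-closed = recoloured colour-c colour-a colour-b (colour-old x<n) (colour-old y<n) (reorder (5F ∷ 2F ∷ 0F ∷ 1F ∷ 3F ∷ 4F ∷ []))

  module ApexA = Apex a-neighbours ((b<n⁺ , a~b) ∷ (c<n⁺ , a~c) ∷ (old<n⁺ y<n , a~y) ∷ (old<n⁺ z<n , a~z) ∷ []) a-closed
  module ApexB = Apex b-neighbours ((a<n⁺ , Adj-sym a~b) ∷ (c<n⁺ , b~c) ∷ (old<n⁺ x<n , b~x) ∷ (old<n⁺ z<n , b~z) ∷ []) b-closed
  module ApexC = Apex c-neighbours ((a<n⁺ , Adj-sym a~c) ∷ (b<n⁺ , Adj-sym b~c) ∷ (old<n⁺ x<n , c~x) ∷ (old<n⁺ y<n , c~y) ∷ []) c-closed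

  colours-grow : ∀ u → colours u ⊆ colours⁺ u
  colours-grow = neighbourColours-mono n≤n⁺ old⊆E⁺ colour-old

  seen⁺ : ∀ {u w i} → w < n⁺ → Adj E⁺ u w → col⁺ w ≡ i → i ∈ colours⁺ u
  seen⁺ {u} w<n⁺ u~w cw≡i = subst (_∈ colours⁺ u) cw≡i (N⁺.∈-neighbourColours⁺ col⁺ w<n⁺ u~w)

  sees-both : ∀ {u p q t} {P Q : Colour} → p < n⁺ → q < n⁺ → Adj E⁺ u p → Adj E⁺ u q → col⁺ p ≡ P → col⁺ q ≡ Q →
              t ∈ P ∷ Q ∷ [] → t ∈ colours⁺ u
  sees-both p<n⁺ _ u~p _ cp≡P _ (here t≡P) = seen⁺ p<n⁺ u~p (trans cp≡P (sym t≡P))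
  sees-both _ q<n⁺ _ u~q _ cq≡Q (there (here t≡Q)) = seen⁺ q<n⁺ u~q (trans cq≡Q (sym t≡Q))

  -- A forbidden colour of a degree-4 corner is none of its own, its neighbours' and the opposite
  -- apex's colours, so it is the colour of one of the two apexes the corner sees.
  x-gains : degree n E x ≡ 4 → fx ∈ colours⁺ x
  x-gains d≡4 = let (own , unseen) = forbidden-free x<n d≡4 in
    sees-both b<n⁺ c<n⁺ (Adj-sym b~x) (Adj-sym c~x) colour-b colour-c
      (∈-excluded (A ∷ X ∷ Y ∷ Z ∷ []) (Unique-full⇒∈ (reorder (0F ∷ 3F ∷ 4F ∷ 5F ∷ 1F ∷ 2F ∷ [])) ≤-refl fx)
        (fx≢A ∷ ≢-sym own ∷ ≢-sym (unseen y y<n x~y) ∷ ≢-sym (unseen z z<n x~z) ∷ []))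

  y-gains : degree n E y ≡ 4 → fy ∈ colours⁺ y
  y-gains d≡4 = let (own , unseen) = forbidden-free y<n d≡4 in
    sees-both a<n⁺ c<n⁺ (Adj-sym a~y) (Adj-sym c~y) colour-a colour-c
      (∈-excluded (B ∷ X ∷ Y ∷ Z ∷ []) (Unique-full⇒∈ (reorder (1F ∷ 3F ∷ 4F ∷ 5F ∷ 0F ∷ 2F ∷ [])) ≤-refl fy)
        (fy≢B ∷ ≢-sym (unseen x x<n (Adj-sym x~y)) ∷ ≢-sym own ∷ ≢-sym (unseen z z<n y~z) ∷ []))

  z-gains : degree n E z ≡ 4 → fz ∈ colours⁺ z
  z-gains d≡4 = let (own , unseen) = forbidden-free z<n d≡4 in
    sees-both a<n⁺ b<n⁺ (Adj-sym a~z) (Adj-sym b~z) colour-a colour-b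
      (∈-excluded (C ∷ X ∷ Y ∷ Z ∷ []) (Unique-full⇒∈ (reorder (2F ∷ 3F ∷ 4F ∷ 5F ∷ 0F ∷ 1F ∷ [])) ≤-refl fz)
        (fz≢C ∷ ≢-sym (unseen x x<n (Adj-sym x~z)) ∷ ≢-sym (unseen y y<n (Adj-sym y~z)) ∷ ≢-sym own ∷ []))

  corner-colours : ∀ {u} → u < n → (degree n E u ≡ 4 → ∃ λ t → InL n E col u t × t ∈ colours⁺ u) →
                   5 ≤ length (colours⁺ u)
  corner-colours {u} u<n gains = by-degree (degree n E u ≟ 4)
    where
    by-degree : Dec (degree n E u ≡ 4) → 5 ≤ length (colours⁺ u)
    by-degree (yes d≡4) =
      let (t , t-free , t∈) = gains d≡4 in
      ≤-trans (s≤s (subst (λ d → 5 ⊓ d ≤ length (colours u)) d≡4 (dynamic u u<n)))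
        (Unique-⊆⇒length≤ (¬Any⇒All¬ _ (N.InL⇒∉neighbourColours col t-free) ∷ N.neighbourColours-unique col u)
          (λ { (here refl) → t∈ ; (there i∈) → colours-grow u i∈ }))
    by-degree (no d≢4) =
      ≤-trans (subst (_≤ length (colours u)) (m≤n⇒m⊓n≡m (≤∧≢⇒< (degree≥4 u u<n) (≢-sym d≢4))) (dynamic u u<n))
        (Unique-⊆⇒length≤ (N.neighbourColours-unique col u) (colours-grow u))

  corner-dynamic : ∀ {u} → u ∈ corners → 5 ≤ length (colours⁺ u)
  corner-dynamic (here refl) = corner-colours x<n (λ d≡4 → fx , forbidden-free x<n d≡4 , x-gains d≡4)
  corner-dynamic (there (here refl)) = corner-colours y<n (λ d≡4 → fy , forbidden-free y<n d≡4 , y-gains d≡4)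
  corner-dynamic (there (there (here refl))) = corner-colours z<n (λ d≡4 → fz , forbidden-free z<n d≡4 , z-gains d≡4)

  old-dynamic : ∀ {v} → v < n → 5 ⊓ degree n⁺ E⁺ v ≤ length (colours⁺ v)
  old-dynamic {v} v<n = by-corner (Any.any? (v ≟_) corners)
    where
    by-corner : Dec (v ∈ corners) → 5 ⊓ degree n⁺ E⁺ v ≤ length (colours⁺ v)
    by-corner (yes v∈corners) = ≤-trans (m⊓n≤m 5 _) (corner-dynamic v∈corners)
    by-corner (no v∉corners) = subst (λ d → 5 ⊓ d ≤ length (colours⁺ v)) (sym (non-corner-degree v<n v∉corners))
      (≤-trans (dynamic v v<n) (Unique-⊆⇒length≤ (N.neighbourColours-unique col v) (colours-grow v)))

  dynamic⁺ : ∀ v → v < n⁺ → 5 ⊓ degree n⁺ E⁺ v ≤ length (colours⁺ v)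
  dynamic⁺ v = by-vertex (λ v → 5 ⊓ degree n⁺ E⁺ v ≤ length (colours⁺ v))
    old-dynamic ApexA.apex-dynamic ApexB.apex-dynamic ApexC.apex-dynamic

  apex-proper : ∀ {v} → v < n⁺ → n ≤ v → ∀ {w} → Adj E⁺ v w → col⁺ v ≢ col⁺ w
  apex-proper = by-vertex (λ v → n ≤ v → ∀ {w} → Adj E⁺ v w → col⁺ v ≢ col⁺ w)
    (λ v<n n≤v → ⊥-elim (new-not-old n≤v v<n)) (λ _ → ApexA.apex-proper) (λ _ → ApexB.apex-proper) (λ _ → ApexC.apex-proper)

  old-proper : ∀ {u} → u < n → ∀ {w} → w < n⁺ → Adj E⁺ u w → col⁺ u ≢ col⁺ w
  old-proper {u} u<n {w} w<n⁺ u~w = by-edge (old-adjacency u<n u~w)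
    where
    by-edge : Adj E u w ⊎ (u ∈ corners × n ≤ w) → col⁺ u ≢ col⁺ w
    by-edge (inj₁ old) = let w<n = proj₂ (Adj-bounded edges-bounded old) in
      subst₂ _≢_ (sym (colour-old u<n)) (sym (colour-old w<n)) (proper u w u<n w<n old)
    by-edge (inj₂ (_ , n≤w)) = ≢-sym (apex-proper w<n⁺ n≤w (Adj-sym u~w))

  proper⁺ : Proper n⁺ E⁺ col⁺
  proper⁺ u w u<n⁺ = by-vertex (λ u → ∀ {w} → w < n⁺ → Adj E⁺ u w → col⁺ u ≢ col⁺ w)
    old-proper (λ _ → ApexA.apex-proper) (λ _ → ApexB.apex-proper) (λ _ → ApexC.apex-proper) u<n⁺

  InL⁺⇒InL : ∀ {u i} → u < n → InL n⁺ E⁺ col⁺ u i → InL n E col u i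
  InL⁺⇒InL u<n (own , unseen) =
    own ∘ trans (colour-old u<n) , λ w w<n u~w → unseen w (old<n⁺ w<n) (old⊆E⁺ u~w) ∘ trans (colour-old w<n)

  InL⇒InL⁺ : ∀ {u i} → u < n → u ∉ corners → InL n E col u i → InL n⁺ E⁺ col⁺ u i
  InL⇒InL⁺ u<n u∉corners (own , unseen) = own ∘ trans (sym (colour-old u<n)) , λ w _ u~w →
    let u~w′ = non-corner-adjacency u<n u∉corners u~w
        w<n = proj₂ (Adj-bounded edges-bounded u~w′)
    in unseen w w<n u~w′ ∘ trans (sym (colour-old w<n))

  old-separated : ∀ {u} → u < n → ∀ {v} → v < n⁺ → Adj E⁺ u v →
                  degree n⁺ E⁺ u ≡ 4 → degree n⁺ E⁺ v ≡ 4 → ¬ SameL n⁺ E⁺ col⁺ u v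
  old-separated {u} u<n {v} _ u~v du dv same =
    separating u v u<n v<n u~v′ (trans (sym (non-corner-degree u<n u∉corners)) du) (trans (sym (non-corner-degree v<n v∉corners)) dv)
      (λ i → InL⁺⇒InL v<n ∘ proj₁ (same i) ∘ InL⇒InL⁺ u<n u∉corners ,
             InL⁺⇒InL u<n ∘ proj₂ (same i) ∘ InL⇒InL⁺ v<n v∉corners)
    where
    u∉corners : u ∉ corners
    u∉corners = degree⁺≡4⇒∉corners du
    v∉corners : v ∉ corners
    v∉corners = degree⁺≡4⇒∉corners dv
    u~v′ : Adj E u v
    u~v′ = non-corner-adjacency u<n u∉corners u~v
    v<n : v < n
    v<n = proj₂ (Adj-bounded edges-bounded u~v′)

  apart : ∀ {u v w m} → InL n⁺ E⁺ col⁺ u m → w < n⁺ → Adj E⁺ v w → col⁺ w ≡ m → ¬ SameL n⁺ E⁺ col⁺ u v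
  apart m-free w<n⁺ v~w cw≡m same = proj₂ (proj₁ (same _) m-free) _ w<n⁺ v~w cw≡m

  a-separated : ∀ {v} → v ∈ b ∷ c ∷ y ∷ z ∷ [] → degree n⁺ E⁺ v ≡ 4 → ¬ SameL n⁺ E⁺ col⁺ a v
  a-separated (here refl) _ = apart ApexA.apex-free (old<n⁺ x<n) b~x (colour-old x<n)
  a-separated (there (here refl)) _ = apart ApexA.apex-free (old<n⁺ x<n) c~x (colour-old x<n)
  a-separated (there (there (here refl))) dv = ⊥-elim (degree⁺≡4⇒∉corners dv (there (here refl)))
  a-separated (there (there (there (here refl)))) dv = ⊥-elim (degree⁺≡4⇒∉corners dv (there (there (here refl))))

  b-separated : ∀ {v} → v ∈ a ∷ c ∷ x ∷ z ∷ [] → degree n⁺ E⁺ v ≡ 4 → ¬ SameL n⁺ E⁺ col⁺ b v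
  b-separated (here refl) _ = apart ApexB.apex-free (old<n⁺ y<n) a~y (colour-old y<n)
  b-separated (there (here refl)) _ = apart ApexB.apex-free (old<n⁺ y<n) c~y (colour-old y<n)
  b-separated (there (there (here refl))) dv = ⊥-elim (degree⁺≡4⇒∉corners dv (here refl))
  b-separated (there (there (there (here refl)))) dv = ⊥-elim (degree⁺≡4⇒∉corners dv (there (there (here refl))))

  c-separated : ∀ {v} → v ∈ a ∷ b ∷ x ∷ y ∷ [] → degree n⁺ E⁺ v ≡ 4 → ¬ SameL n⁺ E⁺ col⁺ c v
  c-separated (here refl) _ = apart ApexC.apex-free (old<n⁺ z<n) a~z (colour-old z<n)
  c-separated (there (here refl)) _ = apart ApexC.apex-free (old<n⁺ z<n) b~z (colour-old z<n)
  c-separated (there (there (here refl))) dv = ⊥-elim (degree⁺≡4⇒∉corners dv (here refl))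
  c-separated (there (there (there (here refl)))) dv = ⊥-elim (degree⁺≡4⇒∉corners dv (there (here refl)))

  separating⁺ : Separating n⁺ E⁺ col⁺
  separating⁺ u v u<n⁺ v<n⁺ =
    by-vertex (λ u → ∀ {v} → v < n⁺ → Adj E⁺ u v → degree n⁺ E⁺ u ≡ 4 → degree n⁺ E⁺ v ≡ 4 → ¬ SameL n⁺ E⁺ col⁺ u v)
    old-separated (λ _ a~v _ → a-separated (a-neighbours a~v)) (λ _ b~v _ → b-separated (b-neighbours b~v))
    (λ _ c~v _ → c-separated (c-neighbours c~v)) u<n⁺ v<n⁺

  degree≥4⁺ : ∀ v → v < n⁺ → 4 ≤ degree n⁺ E⁺ v
  degree≥4⁺ v = by-vertex (λ v → 4 ≤ degree n⁺ E⁺ v) (λ {v} v<n → ≤-trans (degree≥4 v v<n) (degree-mono n≤n⁺ old⊆E⁺ v))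
    (≤-reflexive (sym ApexA.apex-degree)) (≤-reflexive (sym ApexB.apex-degree)) (≤-reflexive (sym ApexC.apex-degree))

  certified⁺ : Certified n⁺ E⁺ F⁺
  certified⁺ = certified (wellFormed edges⁺-bounded faces⁺-triangles degree≥4⁺) col⁺ ((proper⁺ , dynamic⁺) , separating⁺)

-- The first two triangulations, by evaluation

module Decide (n : ℕ) (E : List Edge) where

  all<? : ∀ {P : ℕ → Set} → (∀ v → Dec (P v)) → Dec (∀ v → v < n → P v)
  all<? P? = map′ (λ all-P v → all-P {v}) (λ all-P {v} → all-P v) (allUpTo? P? n)

  all<²? : ∀ {P : ℕ → ℕ → Set} → (∀ u v → Dec (P u v)) → Dec (∀ u v → u < n → v < n → P u v)
  all<²? P? = map′ (λ all-P u v u<n v<n → all-P u u<n v v<n) (λ all-P u u<n v v<n → all-P u v u<n v<n)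
                   (all<? (λ u → all<? (P? u)))

  triangle? : ∀ f → Dec (FaceTriangle n E f)
  triangle? (x , y , z) =
    map′ (λ (x<n , y<n , z<n , x~y , y~z , x~z) → triangle x<n y<n z<n x~y y~z x~z)
         (λ (triangle x<n y<n z<n x~y y~z x~z) → x<n , y<n , z<n , x~y , y~z , x~z)
         (x <? n ×-dec y <? n ×-dec z <? n ×-dec Adj? E x y ×-dec Adj? E y z ×-dec Adj? E x z)

  wellFormed? : ∀ F → Dec (WellFormed n E F)
  wellFormed? F =
    map′ (λ (bounded , triangles , degrees) → wellFormed bounded triangles degrees)
         (λ (wellFormed bounded triangles degrees) → bounded , triangles , degrees)
         (All.all? (λ (u , v) → u <? n ×-dec v <? n) E ×-dec All.all? triangle? F ×-dec all<? (λ v → 4 ≤? degree n E v))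

  goodColouring? : ∀ col → Dec (GoodColouring n E col)
  goodColouring? col =
    (all<²? (λ u v → Adj? E u v →-dec ¬? (col u ≟ᶠ col v)) ×-dec
     all<? (λ v → 5 ⊓ degree n E v ≤? length (neighbourColours n E col v))) ×-dec
    all<²? (λ u v → Adj? E u v →-dec (degree n E u ≟ 4 →-dec (degree n E v ≟ 4 →-dec ¬? (SameL? u v))))
    where
    InL? : ∀ u i → Dec (InL n E col u i)
    InL? u i = ¬? (col u ≟ᶠ i) ×-dec all<? (λ w → Adj? E u w →-dec ¬? (col w ≟ᶠ i))
    SameL? : ∀ u v → Dec (SameL n E col u v)
    SameL? u v = all? (λ i → (InL? u i →-dec InL? v i) ×-dec (InL? v i →-dec InL? u i))

modColouring : Coloring 6
modColouring v = v mod 6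

triangleEdges : List Edge
triangleEdges = (0 , 1) ∷ (1 , 2) ∷ (0 , 2) ∷ []

triangleFaces : List Face
triangleFaces = (0 , 1 , 2) ∷ (0 , 1 , 2) ∷ []

by-decision : ∀ {n E F} → {True (Decide.wellFormed? n E F)} → {True (Decide.goodColouring? n E modColouring)} → Certified n E F
by-decision {n} {E} {F} {well-formed} {good} = certified (toWitness well-formed) modColouring (toWitness good)

-- The invariant needs minimum degree 4, so it starts at the octahedron rather than the triangle.
octahedron : ∀ {x y z} (p : (x , y , z) ∈ triangleFaces) →
             Certified 6 (newEdges 3 x y z ++ triangleEdges) (newFaces 3 x y z ++ (triangleFaces ─ p))
octahedron (here refl) = by-decision
octahedron (there (here refl)) = by-decision

certified-step : ∀ {n E F x y z} → RET n E F → (p : (x , y , z) ∈ F) →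
                 Certified (n + 3) (newEdges n x y z ++ E) (newFaces n x y z ++ (F ─ p))
certified-step base p = octahedron p
certified-step (step ret q) p = Step.certified⁺ well-formed good p
  where open Certified (certified-step ret q)

lemma11 : ∀ {n : ℕ} {E : List Edge} {F : List Face} → RET n E F →
    Σ (Coloring 6) (λ c → Dynamic 5 n E c ×
      (∀ u v → u < n → v < n → Adj E u v →
        degree n E u ≡ 4 → degree n E v ≡ 4 → ¬ SameL n E c u v))
lemma11 base = modColouring , toWitness {a? = Decide.goodColouring? 3 triangleEdges modColouring} _
lemma11 (step ret p) = colouring , good
  where open Certified (certified-step ret p)
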